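{- Let $s,s'\in\mathsf{O}$ with $N(s)=N(s')=2$ and $s\not\equiv s'\pmod{2\mathsf{O}}$. Then $\mathsf{O}s\cap s'\mathsf{O}\neq 2\mathsf{O}$. Moreover, $\mathsf{O}s\cap\mathsf{O}s'=2\mathsf{O}$ if and only if $N(s+s')$ is odd.
   Context: $\mathbb{O}$ is the real octonion algebra with norm $N(x)=x\overline{x}$. Fix a basic triple $(i,j,l)$ (imaginary units with $i\perp j$, $l\perp 1,i,j,ij$), set $i_0=-(ij)l$, $i_1=il$, $i_2=i$, $i_3=j$, $i_4=l$, $i_5=ij$, $i_6=jl$, and $\omega_r=\frac12(-1+i_0+i_r+i_{3r})$ for $r\in\{1,2,4\}$ (indices mod 7); $\mathsf{O}$ is the subring of $\mathbb{O}$ generated by $\omega_1,\omega_2,\omega_4$ (the octavian integers). $\mathsf{O}s=\{xs:x\in\mathsf{O}\}$ and $s\mathsf{O}=\{sx:x\in\mathsf{O}\}$. -}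

module Defs where

open import Data.Rational using (ℚ; 0ℚ; 1ℚ; ½; -½; _+_; _*_; _-_; -_; _/_)
open import Data.Integer using (ℤ)
import Data.Integer as ℤ
open import Data.Product using (Σ; _×_; _,_; ∃)
open import Relation.Binary.PropositionalEquality using (_≡_)

-- Real quaternions (rational coordinates suffice) w.r.t. basis 1, i, j, k=ij
record Quat : Set where
  constructor quat
  field
    q0 q1 q2 q3 : ℚ

_*H_ : Quat → Quat → Quat
quat a1 b1 c1 d1 *H quat a2 b2 c2 d2 = quat
  (a1 * a2 - b1 * b2 - c1 * c2 - d1 * d2)
  (a1 * b2 + b1 * a2 + c1 * d2 - d1 * c2)
  (a1 * c2 - b1 * d2 + c1 * a2 + d1 * b2)
  (a1 * d2 + b1 * c2 - c1 * b2 + d1 * a2)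

_+H_ : Quat → Quat → Quat
quat a1 b1 c1 d1 +H quat a2 b2 c2 d2 = quat (a1 + a2) (b1 + b2) (c1 + c2) (d1 + d2)

-H_ : Quat → Quat
-H quat a b c d = quat (- a) (- b) (- c) (- d)

conjH : Quat → Quat
conjH (quat a b c d) = quat a (- b) (- c) (- d)

0H 1H : Quat
0H = quat 0ℚ 0ℚ 0ℚ 0ℚ
1H = quat 1ℚ 0ℚ 0ℚ 0ℚ

-- Octonions via Cayley–Dickson: (a , b) stands for a + b l,
-- (a + b l)(c + d l) = (a c - conj d b) + (d a + b conj c) l.
-- Then i l = (0 , i), j l = (0 , j), (ij) l = (0 , k).
record Oct : Set where
  constructor oct
  field
    fst snd : Quat

_+O_ : Oct → Oct → Oct
oct a b +O oct c d = oct (a +H c) (b +H d)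

-O_ : Oct → Oct
-O oct a b = oct (-H a) (-H b)

_-O_ : Oct → Oct → Oct
x -O y = x +O (-O y)

_*O_ : Oct → Oct → Oct
oct a b *O oct c d = oct ((a *H c) +H (-H (conjH d *H b))) ((d *H a) +H (b *H conjH c))

conjO : Oct → Oct
conjO (oct a b) = oct (conjH a) (-H b)

0O 1O 2O : Oct
0O = oct 0H 0H
1O = oct 1H 0H
2O = 1O +O 1O

N : Oct → ℚ
N x = Quat.q0 (Oct.fst (x *O conjO x))

-- ω₁ = ½(-1 + i₀ + i₁ + i₃), ω₂ = ½(-1 + i₀ + i₂ + i₆), ω₄ = ½(-1 + i₀ + i₄ + i₅)
-- with i₀ = -(ij)l, i₁ = il, i₂ = i, i₃ = j, i₄ = l, i₅ = ij, i₆ = jl.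
ω₁ ω₂ ω₄ : Oct
ω₁ = oct (quat -½ 0ℚ ½ 0ℚ) (quat 0ℚ ½ 0ℚ -½)
ω₂ = oct (quat -½ ½ 0ℚ 0ℚ) (quat 0ℚ 0ℚ ½ -½)
ω₄ = oct (quat -½ 0ℚ 0ℚ ½) (quat ½ 0ℚ 0ℚ -½)

data InO : Oct → Set where
  gen₁ : InO ω₁
  gen₂ : InO ω₂
  gen₄ : InO ω₄
  one  : InO 1O
  neg  : ∀ {x} → InO x → InO (-O x)
  add  : ∀ {x y} → InO x → InO y → InO (x +O y)
  mul  : ∀ {x y} → InO x → InO y → InO (x *O y)

_∈O·_ : Oct → Oct → Set
z ∈O· s = Σ Oct λ x → InO x × (z ≡ x *O s)

_∈·O_ : Oct → Oct → Set
z ∈·O s = Σ Oct λ x → InO x × (z ≡ s *O x)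

In2O : Oct → Set
In2O z = Σ Oct λ x → InO x × (z ≡ 2O *O x)

SameSet : (Oct → Set) → (Oct → Set) → Set
SameSet A B = ∀ z → (A z → B z) × (B z → A z)

CongMod2O : Oct → Oct → Set
CongMod2O s s' = In2O (s -O s')

OddQ : ℚ → Set
OddQ q = Σ ℤ λ k → q ≡ ((ℤ.+ 2 ℤ.* k ℤ.+ ℤ.+ 1) / 1)

2ℚ : ℚ
2ℚ = 1ℚ + 1ℚ

{-# OPTIONS --safe #-}
module Submission where

-- O is a ℤ-lattice with basis 1, ω₁, ω₂, ω₄, ω₁ω₄, ω₂ω₁, ω₄ω₂, (ω₁ω₄)ω₂, so O/2O is the algebra of
-- coordinate vectors modulo 2, and z ∈ 2O exactly when all coordinates of z are even. Since
-- (z s̄) s = N(s) z = 2z, for N(s) = 2 we have z ∈ O s iff z s̄ ∈ 2O, i.e. iff the class of z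
-- left-annihilates the class of s̄ in O/2O (and similarly for s O). The first claim, and the fact that
-- O s ∩ O s' ≠ 2O when N(s + s') is even, thereby become statements about pairs of isotropic classes
-- a, b of O/2O: there is a nonzero ζ with ζ ā = 0 = b̄ ζ, respectively, if a ⊥ b, with ζ ā = 0 = ζ b̄.
-- Both are checked by enumerating O/2O. Conversely, if z = x s = y s' and N(s + s') = m is odd, then
-- m z = (z (s̄ + s̄')) (s + s') = 2 (x + y) (s + s') ∈ 2O, so z ∈ 2O.

open import Defs
open import Data.Product using (_×_)
open import Relation.Binary.PropositionalEquality using (_≡_)
open import Relation.Nullary using (¬_)
open import Function.Bundles using (_⇔_)

open import Data.Bool using (Bool; true; T; _∧_)
open import Data.Bool.ListAction using (all)
open import Data.Bool.Properties using (T-∧)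
open import Data.Empty using (⊥-elim)
open import Data.Fin using (Fin; combine; _↑ˡ_; _↑ʳ_)
open import Data.Fin.Patterns
open import Data.Integer as ℤ using (ℤ; +_; -[1+_]; _⊖_; ∣_∣; _%ℕ_; _/ℕ_)
import Data.Integer.Properties as ℤ
open import Data.Integer.DivMod using (a≡a%ℕn+[a/ℕn]*n; n%ℕd<d)
open import Data.List as List using (List; []; _∷_; filter)
open import Data.List.Membership.Propositional using (_∈_)
open import Data.List.Membership.Propositional.Properties using (∈-filter⁺; ∈-map⁺; ∈-++⁺ˡ; ∈-++⁺ʳ)
import Data.List.Relation.Unary.All as All
open import Data.List.Relation.Unary.All.Properties using (all⁺)
open import Data.List.Relation.Unary.Any using (Any; here; there; any?; satisfied)
open import Data.Maybe using (just; is-just)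
open import Data.Nat as ℕ using (ℕ; zero; suc; parity; s≤s)
import Data.Nat.Coprimality as Coprime
open import Data.Parity as ℙ using (Parity; 0ℙ; 1ℙ; _⁻¹)
import Data.Parity.Properties as ℙ
open import Data.Product using (∃; _,_; proj₁; swap)
open import Data.Rational as ℚ using (ℚ; mkℚ; _/_; 0ℚ; 1ℚ; ½; -½)
import Data.Rational.Properties as ℚ
open import Data.Rational.Solver using (module +-*-Solver)
open import Data.Sum as Sum using (_⊎_; inj₁; inj₂; map₂)
open import Data.Unit using (tt)
open import Data.Vec using (Vec; []; _∷_; map; zipWith; lookup; head; tabulate; concat; _++_; replicate; _[_]≔_)
open import Data.Vec.Properties
  using (map-∘; map-cong; map-const; map-id; lookup-map; zipWith-comm; ∷-injectiveˡ; ∷-injectiveʳ; ≡-dec)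
open import Data.Vec.Relation.Unary.All using ([]; _∷_) renaming (All to AllV)
open import Function using (_∘_; id; mk⇔; Equivalence)
open import Relation.Binary.PropositionalEquality using (refl; sym; trans; cong; cong₂; subst; subst₂; _≢_; module ≡-Reasoning)
open import Relation.Nullary using (Dec; ¬?)
open import Relation.Nullary.Decidable using (_×-dec_; _⊎-dec_; _→-dec_; toWitness; isYes)

open +-*-Solver using (Polynomial; con; var; _:+_; _:*_; _:-_; :-_; ⟦_⟧; normalise; correct; _≟N_; ⟦_⟧N-cong)
open ≡-Reasoning

fromℤ : ℤ → ℚ
fromℤ i = mkℚ i 0 (Coprime.sym (Coprime.1-coprimeTo ∣ i ∣))

fromℤ-/1 : ∀ i → i / 1 ≡ fromℤ i
fromℤ-/1 i = ℚ.↥p/↧p≡p (fromℤ i)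

-- ℚ addition of two integral rationals unfolds to (i * 1 + j * 1) / 1.
fromℤ-homo-+ : ∀ i j → fromℤ (i ℤ.+ j) ≡ fromℤ i ℚ.+ fromℤ j
fromℤ-homo-+ i j = begin
  fromℤ (i ℤ.+ j)                    ≡⟨ fromℤ-/1 (i ℤ.+ j) ⟨
  (i ℤ.+ j) / 1                      ≡⟨ cong (_/ 1) (cong₂ ℤ._+_ (ℤ.*-identityʳ i) (ℤ.*-identityʳ j)) ⟨
  (i ℤ.* + 1 ℤ.+ j ℤ.* + 1) / 1      ∎

fromℤ-homo-* : ∀ i j → fromℤ (i ℤ.* j) ≡ fromℤ i ℚ.* fromℤ j
fromℤ-homo-* i j = sym (fromℤ-/1 (i ℤ.* j))

fromℤ-homo‿- : ∀ i → fromℤ (ℤ.- i) ≡ ℚ.- fromℤ i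
fromℤ-homo‿- (+ zero)  = refl
fromℤ-homo‿- (+ suc n) = refl
fromℤ-homo‿- -[1+ n ]  = refl

fromℤ-injective : ∀ {i j} → fromℤ i ≡ fromℤ j → i ≡ j
fromℤ-injective = cong ℚ.numerator

parityℤ : ℤ → Parity
parityℤ i = parity ∣ i ∣

private
  parity-suc : ∀ n → parity (suc n) ≡ parity n ⁻¹
  parity-suc n = sym (ℙ.⁻¹-selfInverse (ℙ.suc-homo-⁻¹ n))

  ⁻¹-+-⁻¹ : ∀ p q → p ⁻¹ ℙ.+ q ⁻¹ ≡ p ℙ.+ q
  ⁻¹-+-⁻¹ 0ℙ 0ℙ = refl
  ⁻¹-+-⁻¹ 0ℙ 1ℙ = refl
  ⁻¹-+-⁻¹ 1ℙ 0ℙ = refl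
  ⁻¹-+-⁻¹ 1ℙ 1ℙ = refl

  parity-+-suc : ∀ m n → parity m ℙ.+ parity n ≡ parity (suc m) ℙ.+ parity (suc n)
  parity-+-suc m n = begin
    parity m ℙ.+ parity n                  ≡⟨ ⁻¹-+-⁻¹ (parity m) (parity n) ⟨
    parity m ⁻¹ ℙ.+ parity n ⁻¹            ≡⟨ cong₂ ℙ._+_ (parity-suc m) (parity-suc n) ⟨
    parity (suc m) ℙ.+ parity (suc n)      ∎

  parityℤ-⊖ : ∀ m n → parityℤ (m ⊖ n) ≡ parity m ℙ.+ parity n
  parityℤ-⊖ zero    zero    = refl
  parityℤ-⊖ zero    (suc n) = refl
  parityℤ-⊖ (suc m) zero    = sym (ℙ.+-identityʳ _)
  parityℤ-⊖ (suc m) (suc n) = begin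
    parityℤ (suc m ⊖ suc n)            ≡⟨ cong parityℤ (ℤ.[1+m]⊖[1+n]≡m⊖n m n) ⟩
    parityℤ (m ⊖ n)                    ≡⟨ parityℤ-⊖ m n ⟩
    parity m ℙ.+ parity n              ≡⟨ parity-+-suc m n ⟩
    parity (suc m) ℙ.+ parity (suc n)  ∎

parityℤ-homo-+ : ∀ i j → parityℤ (i ℤ.+ j) ≡ parityℤ i ℙ.+ parityℤ j
parityℤ-homo-+ (+ m)    (+ n)    = ℙ.+-homo-+ m n
parityℤ-homo-+ (+ m)    -[1+ n ] = parityℤ-⊖ m (suc n)
parityℤ-homo-+ -[1+ m ] (+ n)    = trans (parityℤ-⊖ n (suc m)) (ℙ.+-comm (parity n) _)
parityℤ-homo-+ -[1+ m ] -[1+ n ] = trans (ℙ.+-homo-+ m n) (parity-+-suc m n)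

parityℤ-homo-* : ∀ i j → parityℤ (i ℤ.* j) ≡ parityℤ i ℙ.* parityℤ j
parityℤ-homo-* i j = trans (cong parity (ℤ.abs-* i j)) (ℙ.*-homo-* ∣ i ∣ ∣ j ∣)

parityℤ-homo‿- : ∀ i → parityℤ (ℤ.- i) ≡ parityℤ i
parityℤ-homo‿- i = cong parity (ℤ.∣-i∣≡∣i∣ i)

toℤ : Parity → ℤ
toℤ 0ℙ = + 0
toℤ 1ℙ = + 1

parityℤ-toℤ : ∀ p → parityℤ (toℤ p) ≡ p
parityℤ-toℤ 0ℙ = refl
parityℤ-toℤ 1ℙ = refl

i≡2*[i/2]+parity : ∀ i → i ≡ + 2 ℤ.* (i /ℕ 2) ℤ.+ toℤ (parityℤ i)
i≡2*[i/2]+parity i = begin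
  i                                         ≡⟨ a≡a%ℕn+[a/ℕn]*n i 2 ⟩
  + r ℤ.+ q ℤ.* + 2                         ≡⟨ cong (ℤ._+ q ℤ.* + 2) (remainder≡parity r (n%ℕd<d i 2)) ⟩
  toℤ (parity r) ℤ.+ q ℤ.* + 2              ≡⟨ cong (λ p → toℤ p ℤ.+ q ℤ.* + 2) parity-i ⟨
  toℤ (parityℤ i) ℤ.+ q ℤ.* + 2             ≡⟨ ℤ.+-comm _ (q ℤ.* + 2) ⟩
  q ℤ.* + 2 ℤ.+ toℤ (parityℤ i)             ≡⟨ cong (ℤ._+ toℤ (parityℤ i)) (ℤ.*-comm q (+ 2)) ⟩
  + 2 ℤ.* q ℤ.+ toℤ (parityℤ i)             ∎
  where
  r = i %ℕ 2
  q = i /ℕ 2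
  remainder≡parity : ∀ r → r ℕ.< 2 → + r ≡ toℤ (parity r)
  remainder≡parity 0 _ = refl
  remainder≡parity 1 _ = refl
  remainder≡parity (suc (suc r)) (s≤s (s≤s ()))
  parity-i : parityℤ i ≡ parity r
  parity-i = begin
    parityℤ i                               ≡⟨ cong parityℤ (a≡a%ℕn+[a/ℕn]*n i 2) ⟩
    parityℤ (+ r ℤ.+ q ℤ.* + 2)             ≡⟨ parityℤ-homo-+ (+ r) (q ℤ.* + 2) ⟩
    parity r ℙ.+ parityℤ (q ℤ.* + 2)        ≡⟨ cong (parity r ℙ.+_) (parityℤ-homo-* q (+ 2)) ⟩
    parity r ℙ.+ (parityℤ q ℙ.* 0ℙ)         ≡⟨ cong (parity r ℙ.+_) (ℙ.*-zeroʳ (parityℤ q)) ⟩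
    parity r ℙ.+ 0ℙ                         ≡⟨ ℙ.+-identityʳ (parity r) ⟩
    parity r                                ∎

even-or-odd : ∀ i → parityℤ i ≡ 0ℙ ⊎ i ≡ + 2 ℤ.* (i /ℕ 2) ℤ.+ + 1
even-or-odd i with parityℤ i in eq
... | 0ℙ = inj₁ refl
... | 1ℙ = inj₂ (trans (i≡2*[i/2]+parity i) (cong (λ p → + 2 ℤ.* (i /ℕ 2) ℤ.+ toℤ p) eq))

_≈ᵇ_ : ∀ {n} → Polynomial n → Polynomial n → Bool
l ≈ᵇ r = is-just (normalise l ≟N normalise r)

polynomial-identity : ∀ {n} (l r : Polynomial n) → T (l ≈ᵇ r) → ∀ ρ → ⟦ l ⟧ ρ ≡ ⟦ r ⟧ ρ
polynomial-identity l r _ ρ with normalise l ≟N normalise r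
... | just l≈r = trans (sym (correct l ρ)) (trans (⟦ l≈r ⟧N-cong ρ) (correct r ρ))

_≋ᵇ_ : ∀ {n k} → Vec (Polynomial n) k → Vec (Polynomial n) k → Bool
[]       ≋ᵇ []       = true
(l ∷ ls) ≋ᵇ (r ∷ rs) = (l ≈ᵇ r) ∧ (ls ≋ᵇ rs)

polynomial-identities : ∀ {n k} (ls rs : Vec (Polynomial n) k) → T (ls ≋ᵇ rs) →
                        ∀ ρ → map (λ p → ⟦ p ⟧ ρ) ls ≡ map (λ p → ⟦ p ⟧ ρ) rs
polynomial-identities []       []       _ ρ = refl
polynomial-identities (l ∷ ls) (r ∷ rs) t ρ =
  let t₁ , t₂ = Equivalence.to (T-∧ {l ≈ᵇ r}) t
  in cong₂ _∷_ (polynomial-identity l r t₁ ρ) (polynomial-identities ls rs t₂ ρ)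

-- The operations of Defs, transcribed so that ⟦_⟧ₒ commutes with them by definition.
module _ {n : ℕ} where

  record Quatₚ : Set where
    constructor quatₚ
    field q0 q1 q2 q3 : Polynomial n

  record Octₚ : Set where
    constructor octₚ
    field fst snd : Quatₚ

  _*Hₚ_ : Quatₚ → Quatₚ → Quatₚ
  quatₚ a1 b1 c1 d1 *Hₚ quatₚ a2 b2 c2 d2 = quatₚ
    (a1 :* a2 :- b1 :* b2 :- c1 :* c2 :- d1 :* d2)
    (a1 :* b2 :+ b1 :* a2 :+ c1 :* d2 :- d1 :* c2)
    (a1 :* c2 :- b1 :* d2 :+ c1 :* a2 :+ d1 :* b2)
    (a1 :* d2 :+ b1 :* c2 :- c1 :* b2 :+ d1 :* a2)

  _+Hₚ_ : Quatₚ → Quatₚ → Quatₚ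
  quatₚ a1 b1 c1 d1 +Hₚ quatₚ a2 b2 c2 d2 = quatₚ (a1 :+ a2) (b1 :+ b2) (c1 :+ c2) (d1 :+ d2)

  -Hₚ_ : Quatₚ → Quatₚ
  -Hₚ quatₚ a b c d = quatₚ (:- a) (:- b) (:- c) (:- d)

  conjHₚ : Quatₚ → Quatₚ
  conjHₚ (quatₚ a b c d) = quatₚ a (:- b) (:- c) (:- d)

  _+Oₚ_ : Octₚ → Octₚ → Octₚ
  octₚ a b +Oₚ octₚ c d = octₚ (a +Hₚ c) (b +Hₚ d)

  -Oₚ_ : Octₚ → Octₚ
  -Oₚ octₚ a b = octₚ (-Hₚ a) (-Hₚ b)

  _-Oₚ_ : Octₚ → Octₚ → Octₚ
  x -Oₚ y = x +Oₚ (-Oₚ y)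

  _*Oₚ_ : Octₚ → Octₚ → Octₚ
  octₚ a b *Oₚ octₚ c d = octₚ ((a *Hₚ c) +Hₚ (-Hₚ (conjHₚ d *Hₚ b))) ((d *Hₚ a) +Hₚ (b *Hₚ conjHₚ c))

  conjOₚ : Octₚ → Octₚ
  conjOₚ (octₚ a b) = octₚ (conjHₚ a) (-Hₚ b)

  Nₚ : Octₚ → Polynomial n
  Nₚ x = Quatₚ.q0 (Octₚ.fst (x *Oₚ conjOₚ x))

  scaleₚ : Polynomial n → Octₚ → Octₚ
  scaleₚ t (octₚ (quatₚ a b c d) (quatₚ e f g h)) =
    octₚ (quatₚ (t :* a) (t :* b) (t :* c) (t :* d)) (quatₚ (t :* e) (t :* f) (t :* g) (t :* h))

  realₚ : Polynomial n → Octₚ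
  realₚ t = octₚ (quatₚ t (con 0ℚ) (con 0ℚ) (con 0ℚ)) (quatₚ (con 0ℚ) (con 0ℚ) (con 0ℚ) (con 0ℚ))

  constₚ : Oct → Octₚ
  constₚ (oct (quat a b c d) (quat e f g h)) =
    octₚ (quatₚ (con a) (con b) (con c) (con d)) (quatₚ (con e) (con f) (con g) (con h))

  2Oₚ : Octₚ
  2Oₚ = constₚ 2O

  coordinatesₚ : Octₚ → Vec (Polynomial n) 8
  coordinatesₚ (octₚ (quatₚ a b c d) (quatₚ e f g h)) = a ∷ b ∷ c ∷ d ∷ e ∷ f ∷ g ∷ h ∷ []

  ⟦_⟧ₒ : Octₚ → Vec ℚ n → Oct
  ⟦ octₚ (quatₚ a b c d) (quatₚ e f g h) ⟧ₒ ρ =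
    oct (quat (⟦ a ⟧ ρ) (⟦ b ⟧ ρ) (⟦ c ⟧ ρ) (⟦ d ⟧ ρ)) (quat (⟦ e ⟧ ρ) (⟦ f ⟧ ρ) (⟦ g ⟧ ρ) (⟦ h ⟧ ρ))

coordinates : Oct → Vec ℚ 8
coordinates (oct (quat a b c d) (quat e f g h)) = a ∷ b ∷ c ∷ d ∷ e ∷ f ∷ g ∷ h ∷ []

coordinates-injective : ∀ {x y} → coordinates x ≡ coordinates y → x ≡ y
coordinates-injective {oct (quat _ _ _ _) (quat _ _ _ _)} {oct (quat _ _ _ _) (quat _ _ _ _)} refl = refl

-- The ends x, y are given by `refl`, so that Agda unfolds x against ⟦ l ⟧ₒ ρ (and y against ⟦ r ⟧ₒ ρ)
-- in this direction; unifying the result type the other way round can be orders of magnitude slower.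
octonion-identity : ∀ {n} (l r : Octₚ {n}) → T (coordinatesₚ l ≋ᵇ coordinatesₚ r) →
                    ∀ ρ {x y} → x ≡ ⟦ l ⟧ₒ ρ → y ≡ ⟦ r ⟧ₒ ρ → x ≡ y
octonion-identity l r t ρ x≡l y≡r =
  trans x≡l (trans (coordinates-injective (polynomial-identities (coordinatesₚ l) (coordinatesₚ r) t ρ)) (sym y≡r))

module Variables (k m : ℕ) where

  𝕩 : Fin k → Octₚ {k ℕ.* 8 ℕ.+ m}
  𝕩 i = octₚ (quatₚ (v 0F) (v 1F) (v 2F) (v 3F)) (quatₚ (v 4F) (v 5F) (v 6F) (v 7F))
    where
    v : Fin 8 → Polynomial (k ℕ.* 8 ℕ.+ m)
    v j = var (combine i j ↑ˡ m)

  𝕥 : Fin m → Polynomial (k ℕ.* 8 ℕ.+ m)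
  𝕥 j = var (k ℕ.* 8 ↑ʳ j)

  env : Vec Oct k → Vec ℚ m → Vec ℚ (k ℕ.* 8 ℕ.+ m)
  env xs ts = concat (map coordinates xs) ++ ts

scale : ℚ → Oct → Oct
scale t (oct (quat a b c d) (quat e f g h)) =
  oct (quat (t ℚ.* a) (t ℚ.* b) (t ℚ.* c) (t ℚ.* d)) (quat (t ℚ.* e) (t ℚ.* f) (t ℚ.* g) (t ℚ.* h))

real : ℚ → Oct
real t = oct (quat t 0ℚ 0ℚ 0ℚ) 0H

conj-* : ∀ x y → conjO (x *O y) ≡ conjO y *O conjO x
conj-* x y = octonion-identity (conjOₚ (X *Oₚ Y)) (conjOₚ Y *Oₚ conjOₚ X) tt (env (x ∷ y ∷ []) []) refl refl
  where open Variables 2 0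
        X = 𝕩 0F
        Y = 𝕩 1F

conj-involutive : ∀ x → conjO (conjO x) ≡ x
conj-involutive x = octonion-identity (conjOₚ (conjOₚ X)) X tt (env (x ∷ []) []) refl refl
  where open Variables 1 0
        X = 𝕩 0F

conj-+ : ∀ x y → conjO (x +O y) ≡ conjO x +O conjO y
conj-+ x y = octonion-identity (conjOₚ (X +Oₚ Y)) (conjOₚ X +Oₚ conjOₚ Y) tt (env (x ∷ y ∷ []) []) refl refl
  where open Variables 2 0
        X = 𝕩 0F
        Y = 𝕩 1F

conj-scale : ∀ t x → conjO (scale t x) ≡ scale t (conjO x)
conj-scale t x = octonion-identity (conjOₚ (scaleₚ S X)) (scaleₚ S (conjOₚ X)) tt (env (x ∷ []) (t ∷ [])) refl refl
  where open Variables 1 1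
        X = 𝕩 0F
        S = 𝕥 0F

N-conj : ∀ x → N (conjO x) ≡ N x
N-conj x = polynomial-identity (Nₚ (conjOₚ X)) (Nₚ X) tt (env (x ∷ []) [])
  where open Variables 1 0
        X = 𝕩 0F

*-conj : ∀ x → x *O conjO x ≡ real (N x)
*-conj x = octonion-identity (X *Oₚ conjOₚ X) (realₚ (Nₚ X)) tt (env (x ∷ []) []) refl refl
  where open Variables 1 0
        X = 𝕩 0F

*-conj-* : ∀ x a → (x *O conjO a) *O a ≡ scale (N a) x
*-conj-* x a = octonion-identity ((X *Oₚ conjOₚ A) *Oₚ A) (scaleₚ (Nₚ A) X) tt (env (a ∷ x ∷ []) []) refl refl
  where open Variables 2 0
        A = 𝕩 0F
        X = 𝕩 1F

*-distribˡ-+ : ∀ x y z → x *O (y +O z) ≡ (x *O y) +O (x *O z)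
*-distribˡ-+ x y z =
  octonion-identity (X *Oₚ (Y +Oₚ Z)) ((X *Oₚ Y) +Oₚ (X *Oₚ Z)) tt (env (x ∷ y ∷ z ∷ []) []) refl refl
  where open Variables 3 0
        X = 𝕩 0F
        Y = 𝕩 1F
        Z = 𝕩 2F

scale-*ˡ : ∀ t x y → scale t x *O y ≡ scale t (x *O y)
scale-*ˡ t x y = octonion-identity (scaleₚ S X *Oₚ Y) (scaleₚ S (X *Oₚ Y)) tt (env (x ∷ y ∷ []) (t ∷ [])) refl refl
  where open Variables 2 1
        X = 𝕩 0F
        Y = 𝕩 1F
        S = 𝕥 0F

scale-*ʳ : ∀ t x y → x *O scale t y ≡ scale t (x *O y)
scale-*ʳ t x y = octonion-identity (X *Oₚ scaleₚ S Y) (scaleₚ S (X *Oₚ Y)) tt (env (x ∷ y ∷ []) (t ∷ [])) refl refl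
  where open Variables 2 1
        X = 𝕩 0F
        Y = 𝕩 1F
        S = 𝕥 0F

real-* : ∀ t x → real t *O x ≡ scale t x
real-* t x = octonion-identity (realₚ S *Oₚ X) (scaleₚ S X) tt (env (x ∷ []) (t ∷ [])) refl refl
  where open Variables 1 1
        X = 𝕩 0F
        S = 𝕥 0F

2O-* : ∀ x → 2O *O x ≡ scale 2ℚ x
2O-* x = octonion-identity (2Oₚ *Oₚ X) (scaleₚ (con 2ℚ) X) tt (env (x ∷ []) []) refl refl
  where open Variables 1 0
        X = 𝕩 0F

2O-*-distrib-minus : ∀ x y → 2O *O (x -O y) ≡ (2O *O x) -O (2O *O y)
2O-*-distrib-minus x y =
  octonion-identity (2Oₚ *Oₚ (X -Oₚ Y)) ((2Oₚ *Oₚ X) -Oₚ (2Oₚ *Oₚ Y)) tt (env (x ∷ y ∷ []) []) refl refl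
  where open Variables 2 0
        X = 𝕩 0F
        Y = 𝕩 1F

scale-½-2 : ∀ x → scale ½ (scale 2ℚ x) ≡ x
scale-½-2 x = octonion-identity (scaleₚ (con ½) (scaleₚ (con 2ℚ) X)) X tt (env (x ∷ []) []) refl refl
  where open Variables 1 0
        X = 𝕩 0F

scale-odd-minus-double : ∀ t x → scale (2ℚ ℚ.* t ℚ.+ 1ℚ) x -O (2O *O scale t x) ≡ x
scale-odd-minus-double t x =
  octonion-identity (scaleₚ (con 2ℚ :* S :+ con 1ℚ) X -Oₚ (2Oₚ *Oₚ scaleₚ S X)) X tt (env (x ∷ []) (t ∷ [])) refl refl
  where open Variables 1 1
        X = 𝕩 0F
        S = 𝕥 0F

*-*-conj : ∀ x a → (x *O a) *O conjO a ≡ scale (N a) x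
*-*-conj x a = begin
  (x *O a) *O conjO a                  ≡⟨ cong (λ b → (x *O b) *O conjO a) (conj-involutive a) ⟨
  (x *O conjO (conjO a)) *O conjO a    ≡⟨ *-conj-* x (conjO a) ⟩
  scale (N (conjO a)) x                ≡⟨ cong (λ t → scale t x) (N-conj a) ⟩
  scale (N a) x                        ∎

conj-*-* : ∀ a x → a *O (conjO a *O x) ≡ scale (N a) x
conj-*-* a x = begin
  a *O (conjO a *O x)                          ≡⟨ conj-involutive _ ⟨
  conjO (conjO (a *O (conjO a *O x)))          ≡⟨ cong conjO conjugate ⟩
  conjO (scale (N a) (conjO x))                ≡⟨ conj-scale (N a) (conjO x) ⟩
  scale (N a) (conjO (conjO x))                ≡⟨ cong (scale (N a)) (conj-involutive x) ⟩
  scale (N a) x                                ∎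
  where
  conjugate : conjO (a *O (conjO a *O x)) ≡ scale (N a) (conjO x)
  conjugate = begin
    conjO (a *O (conjO a *O x))                ≡⟨ conj-* a (conjO a *O x) ⟩
    conjO (conjO a *O x) *O conjO a            ≡⟨ cong (_*O conjO a) (conj-* (conjO a) x) ⟩
    (conjO x *O conjO (conjO a)) *O conjO a    ≡⟨ cong (λ b → (conjO x *O b) *O conjO a) (conj-involutive a) ⟩
    (conjO x *O a) *O conjO a                  ≡⟨ *-*-conj (conjO x) a ⟩
    scale (N a) (conjO x)                      ∎

scale-2-injective : ∀ {x y} → scale 2ℚ x ≡ scale 2ℚ y → x ≡ y
scale-2-injective {x} {y} eq = trans (sym (scale-½-2 x)) (trans (cong (scale ½) eq) (scale-½-2 y))

2O-*ˡ : ∀ x y → (2O *O x) *O y ≡ 2O *O (x *O y)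
2O-*ˡ x y = trans (cong (_*O y) (2O-* x)) (trans (scale-*ˡ 2ℚ x y) (sym (2O-* (x *O y))))

2O-*ʳ : ∀ x y → x *O (2O *O y) ≡ 2O *O (x *O y)
2O-*ʳ x y = trans (cong (x *O_) (2O-* y)) (trans (scale-*ʳ 2ℚ x y) (sym (2O-* (x *O y))))

divide-right : ∀ s z x → N s ≡ 2ℚ → z *O conjO s ≡ 2O *O x → z ≡ x *O s
divide-right s z x Ns z*s̄≡2x = scale-2-injective (begin
  scale 2ℚ z               ≡⟨ cong (λ t → scale t z) Ns ⟨
  scale (N s) z            ≡⟨ *-conj-* z s ⟨
  (z *O conjO s) *O s      ≡⟨ cong (_*O s) z*s̄≡2x ⟩
  (2O *O x) *O s           ≡⟨ 2O-*ˡ x s ⟩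
  2O *O (x *O s)           ≡⟨ 2O-* (x *O s) ⟩
  scale 2ℚ (x *O s)        ∎)

divide-left : ∀ s z y → N s ≡ 2ℚ → conjO s *O z ≡ 2O *O y → z ≡ s *O y
divide-left s z y Ns s̄*z≡2y = scale-2-injective (begin
  scale 2ℚ z               ≡⟨ cong (λ t → scale t z) Ns ⟨
  scale (N s) z            ≡⟨ conj-*-* s z ⟨
  s *O (conjO s *O z)      ≡⟨ cong (s *O_) s̄*z≡2y ⟩
  s *O (2O *O y)           ≡⟨ 2O-*ʳ s y ⟩
  2O *O (s *O y)           ≡⟨ 2O-* (s *O y) ⟩
  scale 2ℚ (s *O y)        ∎)

-- Coordinates with respect to `basis` below. The formula for _∙_ lists the structure constants of O,
-- computed beforehand and verified by `fromBasis-∙`.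
module Coordinates {A : Set} (plus times : A → A → A) (negate : A → A) where

  infixl 6 _+_ _-_ _⊞_
  infixl 7 _*_ _∙_
  infix  8 -_ ⊟_

  -_ : A → A
  -_ = negate

  _+_ _*_ _-_ : A → A → A
  _+_ = plus
  _*_ = times
  a - b = a + - b

  _∙_ : Vec A 8 → Vec A 8 → Vec A 8
  (x₀ ∷ x₁ ∷ x₂ ∷ x₃ ∷ x₄ ∷ x₅ ∷ x₆ ∷ x₇ ∷ []) ∙ (y₀ ∷ y₁ ∷ y₂ ∷ y₃ ∷ y₄ ∷ y₅ ∷ y₆ ∷ y₇ ∷ []) =
      x₀ * y₀ + x₁ * y₅ + x₁ * y₇ + x₂ * y₆ + x₃ * y₄ + x₄ * y₁ + x₅ * y₂ + x₆ * y₃ + x₇ * y₄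
        + x₇ * y₆ - x₁ * y₁ - x₁ * y₂ - x₂ * y₂ - x₂ * y₃ - x₃ * y₁ - x₃ * y₃ - x₄ * y₄ - x₅ * y₅
        - x₅ * y₇ - x₆ * y₆ - x₇ * y₁ - x₇ * y₃ - x₇ * y₇
    ∷ x₀ * y₁ + x₁ * y₀ + x₃ * y₄ + x₅ * y₂ + x₇ * y₆ - x₁ * y₁ - x₁ * y₂ - x₂ * y₅ - x₃ * y₁
        - x₄ * y₃ - x₆ * y₇
    ∷ x₀ * y₂ + x₁ * y₅ + x₁ * y₇ + x₂ * y₀ + x₃ * y₇ + x₆ * y₃ + x₇ * y₄ - x₁ * y₂ - x₂ * y₂
        - x₂ * y₃ - x₃ * y₆ - x₄ * y₇ - x₅ * y₁ - x₇ * y₁ - x₇ * y₃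
    ∷ x₀ * y₃ + x₁ * y₇ + x₂ * y₆ + x₃ * y₀ + x₄ * y₁ + x₇ * y₅ - x₁ * y₄ - x₂ * y₃ - x₃ * y₁
        - x₃ * y₃ - x₅ * y₇ - x₆ * y₂ - x₇ * y₁
    ∷ x₀ * y₄ + x₁ * y₃ + x₁ * y₇ + x₂ * y₇ + x₄ * y₀ + x₅ * y₆ + x₆ * y₁ + x₇ * y₅ + x₇ * y₆
        - x₁ * y₄ - x₁ * y₆ - x₂ * y₄ - x₃ * y₁ - x₄ * y₃ - x₅ * y₇ - x₆ * y₅ - x₆ * y₇ - x₇ * y₁
        - x₇ * y₂
    ∷ x₀ * y₅ + x₁ * y₆ + x₂ * y₁ + x₃ * y₇ + x₅ * y₀ + x₆ * y₄ + x₇ * y₆ - x₁ * y₂ - x₂ * y₅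
        - x₄ * y₆ - x₅ * y₁ - x₅ * y₃ - x₆ * y₁ - x₆ * y₇ - x₇ * y₃
    ∷ x₀ * y₆ + x₁ * y₇ + x₃ * y₂ + x₄ * y₅ + x₅ * y₃ + x₆ * y₀ - x₁ * y₆ - x₂ * y₃ - x₃ * y₅
        - x₃ * y₆ - x₅ * y₄ - x₆ * y₂ - x₇ * y₁
    ∷ x₀ * y₇ + x₄ * y₂ + x₅ * y₃ + x₆ * y₁ + x₇ * y₀ - x₁ * y₆ - x₂ * y₄ - x₃ * y₅ - x₃ * y₇
        - x₇ * y₁ - x₇ * y₂
    ∷ []

  conj : Vec A 8 → Vec A 8
  conj (x₀ ∷ x₁ ∷ x₂ ∷ x₃ ∷ x₄ ∷ x₅ ∷ x₆ ∷ x₇ ∷ []) =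
    x₀ - x₁ - x₂ - x₃ ∷ - x₁ ∷ - x₂ ∷ - x₃ ∷ - x₄ ∷ - x₅ ∷ - x₆ ∷ - x₇ ∷ []

  -- The first basis vector is 1, so the norm is the first coordinate of u ū.
  norm : Vec A 8 → A
  norm u = head (u ∙ conj u)

  _⊞_ : ∀ {n} → Vec A n → Vec A n → Vec A n
  _⊞_ = zipWith plus

  ⊟_ : ∀ {n} → Vec A n → Vec A n
  ⊟_ = map negate

module Syntax where

  infixl 6 _⊕_
  infixl 7 _⊗_
  infix  8 ⊝_

  data Expr : Set where
    x y     : Fin 8 → Expr
    _⊕_ _⊗_ : Expr → Expr → Expr
    ⊝_      : Expr → Expr

  module Exprᶜ = Coordinates _⊕_ _⊗_ ⊝_

  X Y : Vec Expr 8
  X = tabulate x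
  Y = tabulate y

  module Evaluation {A : Set} (plus times : A → A → A) (negate : A → A) where
    open Coordinates plus times negate

    eval : Expr → Vec A 8 → Vec A 8 → A
    eval (x i)   u v = lookup u i
    eval (y i)   u v = lookup v i
    eval (a ⊕ b) u v = eval a u v + eval b u v
    eval (a ⊗ b) u v = eval a u v * eval b u v
    eval (⊝ a)   u v = - eval a u v

    -- Instantiating the formulas at the variables x, y gives their syntax trees, which evaluate back.
    ∙-eval : ∀ u v → u ∙ v ≡ map (λ e → eval e u v) (X Exprᶜ.∙ Y)
    ∙-eval (_ ∷ _ ∷ _ ∷ _ ∷ _ ∷ _ ∷ _ ∷ _ ∷ []) (_ ∷ _ ∷ _ ∷ _ ∷ _ ∷ _ ∷ _ ∷ _ ∷ []) = refl

    conj-eval : ∀ u → conj u ≡ map (λ e → eval e u u) (Exprᶜ.conj X)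
    conj-eval (_ ∷ _ ∷ _ ∷ _ ∷ _ ∷ _ ∷ _ ∷ _ ∷ []) = refl

module Homomorphism {A B : Set}
  (_+ᴬ_ _*ᴬ_ : A → A → A) (-ᴬ_ : A → A) (_+ᴮ_ _*ᴮ_ : B → B → B) (-ᴮ_ : B → B) (f : A → B)
  (f-+ : ∀ a b → f (a +ᴬ b) ≡ f a +ᴮ f b)
  (f-* : ∀ a b → f (a *ᴬ b) ≡ f a *ᴮ f b)
  (f-‿ : ∀ a → f (-ᴬ a) ≡ -ᴮ f a) where

  open Syntax
  private
    module A = Coordinates _+ᴬ_ _*ᴬ_ -ᴬ_
    module B = Coordinates _+ᴮ_ _*ᴮ_ -ᴮ_
    module evalᴬ = Evaluation _+ᴬ_ _*ᴬ_ -ᴬ_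
    module evalᴮ = Evaluation _+ᴮ_ _*ᴮ_ -ᴮ_

  eval-homo : ∀ e u v → f (evalᴬ.eval e u v) ≡ evalᴮ.eval e (map f u) (map f v)
  eval-homo (x i)   u v = sym (lookup-map i f u)
  eval-homo (y i)   u v = sym (lookup-map i f v)
  eval-homo (a ⊕ b) u v = trans (f-+ _ _) (cong₂ _+ᴮ_ (eval-homo a u v) (eval-homo b u v))
  eval-homo (a ⊗ b) u v = trans (f-* _ _) (cong₂ _*ᴮ_ (eval-homo a u v) (eval-homo b u v))
  eval-homo (⊝ a)   u v = trans (f-‿ _) (cong -ᴮ_ (eval-homo a u v))

  map-∙ : ∀ u v → map f (u A.∙ v) ≡ map f u B.∙ map f v
  map-∙ u v = begin
    map f (u A.∙ v)                                      ≡⟨ cong (map f) (evalᴬ.∙-eval u v) ⟩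
    map f (map (λ e → evalᴬ.eval e u v) table)           ≡⟨ map-∘ f (λ e → evalᴬ.eval e u v) table ⟨
    map (λ e → f (evalᴬ.eval e u v)) table               ≡⟨ map-cong (λ e → eval-homo e u v) table ⟩
    map (λ e → evalᴮ.eval e (map f u) (map f v)) table   ≡⟨ evalᴮ.∙-eval (map f u) (map f v) ⟨
    map f u B.∙ map f v                                  ∎
    where table = X Exprᶜ.∙ Y

  map-conj : ∀ u → map f (A.conj u) ≡ B.conj (map f u)
  map-conj u = begin
    map f (A.conj u)                                     ≡⟨ cong (map f) (evalᴬ.conj-eval u) ⟩
    map f (map (λ e → evalᴬ.eval e u u) table)           ≡⟨ map-∘ f (λ e → evalᴬ.eval e u u) table ⟨
    map (λ e → f (evalᴬ.eval e u u)) table               ≡⟨ map-cong (λ e → eval-homo e u u) table ⟩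
    map (λ e → evalᴮ.eval e (map f u) (map f u)) table   ≡⟨ evalᴮ.conj-eval (map f u) ⟨
    B.conj (map f u)                                     ∎
    where table = Exprᶜ.conj X

  norm-homo : ∀ u → f (A.norm u) ≡ B.norm (map f u)
  norm-homo u@(_ ∷ _ ∷ _ ∷ _ ∷ _ ∷ _ ∷ _ ∷ _ ∷ []) = cong head (begin
    map f (u A.∙ A.conj u)          ≡⟨ map-∙ u (A.conj u) ⟩
    map f u B.∙ map f (A.conj u)    ≡⟨ cong (map f u B.∙_) (map-conj u) ⟩
    map f u B.∙ B.conj (map f u)    ∎)

  map-⊞ : ∀ {n} (u v : Vec A n) → map f (u A.⊞ v) ≡ map f u B.⊞ map f v
  map-⊞ []      []      = refl
  map-⊞ (a ∷ u) (b ∷ v) = cong₂ _∷_ (f-+ a b) (map-⊞ u v)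

  map-⊟ : ∀ {n} (u : Vec A n) → map f (A.⊟ u) ≡ B.⊟ map f u
  map-⊟ u = trans (sym (map-∘ f -ᴬ_ u)) (trans (map-cong f-‿ u) (map-∘ -ᴮ_ f u))

module ℚᶜ = Coordinates ℚ._+_ ℚ._*_ ℚ.-_
module ℤᶜ = Coordinates ℤ._+_ ℤ._*_ ℤ.-_
module Polynomialᶜ {n} = Coordinates (_:+_ {n}) _:*_ :-_
module fromℤ-homomorphism = Homomorphism ℤ._+_ ℤ._*_ ℤ.-_ ℚ._+_ ℚ._*_ ℚ.-_ fromℤ fromℤ-homo-+ fromℤ-homo-* fromℤ-homo‿-

-- The lattice O

-- 1, ω₁, ω₂, ω₄, ω₁ω₄, ω₂ω₁, ω₄ω₂ and (ω₁ω₄)ω₂, the last four with their coordinates computed.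
basis : Vec Oct 8
basis = 1O ∷ ω₁ ∷ ω₂ ∷ ω₄
  ∷ oct (quat 0ℚ 0ℚ -½ 0ℚ) (quat -½ 0ℚ ½ ½)
  ∷ oct (quat 0ℚ 0ℚ 0ℚ ½) (quat 0ℚ -½ -½ ½)
  ∷ oct (quat 0ℚ -½ ½ -½) (quat 0ℚ 0ℚ 0ℚ ½)
  ∷ oct (quat 0ℚ ½ 0ℚ ½) (quat ½ 0ℚ -½ 0ℚ)
  ∷ []

basis-∈O : AllV InO basis
basis-∈O = one ∷ gen₁ ∷ gen₂ ∷ gen₄ ∷ mul gen₁ gen₄ ∷ mul gen₂ gen₁ ∷ mul gen₄ gen₂ ∷ mul (mul gen₁ gen₄) gen₂ ∷ []

combination : ∀ {n} → Vec ℚ n → Vec Oct n → Oct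
combination []       []       = 0O
combination (t ∷ ts) (b ∷ bs) = scale t b +O combination ts bs

combinationₚ : ∀ {n k} → Vec (Polynomial n) k → Vec Oct k → Octₚ {n}
combinationₚ []       []       = constₚ 0O
combinationₚ (t ∷ ts) (b ∷ bs) = scaleₚ t (constₚ b) +Oₚ combinationₚ ts bs

fromBasis : Vec ℚ 8 → Oct
fromBasis u = combination u basis

octavian : Vec ℤ 8 → Oct
octavian c = fromBasis (map fromℤ c)

basisCoordinates : Oct → Vec ℚ 8
basisCoordinates (oct (quat a b c d) (quat e f g h)) =
  a ℚ.+ c ℚ.+ d ℚ.+ g ∷ c ℚ.+ d ℚ.- e ℚ.+ f ∷ b ℚ.+ c ℚ.- f ℚ.+ g ∷ ℚ.- b ℚ.+ d ℚ.+ e ℚ.+ g ∷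
  d ℚ.+ f ℚ.+ g ℚ.+ h ∷ c ℚ.+ d ℚ.- e ℚ.- f ∷ c ℚ.+ e ℚ.+ g ℚ.+ h ∷ b ℚ.+ e ℚ.+ f ℚ.+ h ∷ []

basisCoordinatesₚ : ∀ {n} → Octₚ {n} → Vec (Polynomial n) 8
basisCoordinatesₚ (octₚ (quatₚ a b c d) (quatₚ e f g h)) =
  a :+ c :+ d :+ g ∷ c :+ d :- e :+ f ∷ b :+ c :- f :+ g ∷ :- b :+ d :+ e :+ g ∷
  d :+ f :+ g :+ h ∷ c :+ d :- e :- f ∷ c :+ e :+ g :+ h ∷ b :+ e :+ f :+ h ∷ []

private
  module Two-vectors where
    open Variables 0 16 public
    X Y : Vec (Polynomial 16) 8
    X = tabulate (λ i → 𝕥 (i ↑ˡ 8))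
    Y = tabulate (λ i → 𝕥 (8 ↑ʳ i))

  module One-vector where
    open Variables 0 8 public
    X : Vec (Polynomial 8) 8
    X = tabulate 𝕥

basisCoordinates-fromBasis : ∀ u → basisCoordinates (fromBasis u) ≡ u
basisCoordinates-fromBasis u@(_ ∷ _ ∷ _ ∷ _ ∷ _ ∷ _ ∷ _ ∷ _ ∷ []) =
  polynomial-identities (basisCoordinatesₚ (combinationₚ X basis)) X tt (env [] u)
  where open One-vector

head-basisCoordinates-real : ∀ t → head (basisCoordinates (real t)) ≡ t
head-basisCoordinates-real t = polynomial-identity (head (basisCoordinatesₚ (realₚ S))) S tt (env [] (t ∷ []))
  where open Variables 0 1
        S = 𝕥 0F

fromBasis-∙ : ∀ u v → fromBasis u *O fromBasis v ≡ fromBasis (u ℚᶜ.∙ v)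
fromBasis-∙ u@(_ ∷ _ ∷ _ ∷ _ ∷ _ ∷ _ ∷ _ ∷ _ ∷ []) v@(_ ∷ _ ∷ _ ∷ _ ∷ _ ∷ _ ∷ _ ∷ _ ∷ []) =
  octonion-identity (combinationₚ X basis *Oₚ combinationₚ Y basis) (combinationₚ (X Polynomialᶜ.∙ Y) basis)
                    tt (env [] (u ++ v)) refl refl
  where open Two-vectors

fromBasis-conj : ∀ u → conjO (fromBasis u) ≡ fromBasis (ℚᶜ.conj u)
fromBasis-conj u@(_ ∷ _ ∷ _ ∷ _ ∷ _ ∷ _ ∷ _ ∷ _ ∷ []) =
  octonion-identity (conjOₚ (combinationₚ X basis)) (combinationₚ (Polynomialᶜ.conj X) basis) tt (env [] u) refl refl
  where open One-vector

fromBasis-⊞ : ∀ u v → fromBasis u +O fromBasis v ≡ fromBasis (u ℚᶜ.⊞ v)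
fromBasis-⊞ u@(_ ∷ _ ∷ _ ∷ _ ∷ _ ∷ _ ∷ _ ∷ _ ∷ []) v@(_ ∷ _ ∷ _ ∷ _ ∷ _ ∷ _ ∷ _ ∷ _ ∷ []) =
  octonion-identity (combinationₚ X basis +Oₚ combinationₚ Y basis) (combinationₚ (X Polynomialᶜ.⊞ Y) basis)
                    tt (env [] (u ++ v)) refl refl
  where open Two-vectors

fromBasis-⊟ : ∀ u → -O fromBasis u ≡ fromBasis (ℚᶜ.⊟ u)
fromBasis-⊟ u@(_ ∷ _ ∷ _ ∷ _ ∷ _ ∷ _ ∷ _ ∷ _ ∷ []) =
  octonion-identity (-Oₚ combinationₚ X basis) (combinationₚ (Polynomialᶜ.⊟ X) basis) tt (env [] u) refl refl
  where open One-vector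

fromBasis-scale : ∀ t u → scale t (fromBasis u) ≡ fromBasis (map (t ℚ.*_) u)
fromBasis-scale t u@(_ ∷ _ ∷ _ ∷ _ ∷ _ ∷ _ ∷ _ ∷ _ ∷ []) =
  octonion-identity (scaleₚ S (combinationₚ X basis)) (combinationₚ (map (S :*_) X) basis)
                    tt (env [] (u ++ t ∷ [])) refl refl
  where open Variables 0 9
        X = tabulate (λ i → 𝕥 (i ↑ˡ 1))
        S = 𝕥 8F

octavian-∙ : ∀ c d → octavian c *O octavian d ≡ octavian (c ℤᶜ.∙ d)
octavian-∙ c d = trans (fromBasis-∙ (map fromℤ c) (map fromℤ d)) (cong fromBasis (sym (fromℤ-homomorphism.map-∙ c d)))

octavian-conj : ∀ c → conjO (octavian c) ≡ octavian (ℤᶜ.conj c)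
octavian-conj c = trans (fromBasis-conj (map fromℤ c)) (cong fromBasis (sym (fromℤ-homomorphism.map-conj c)))

octavian-⊞ : ∀ c d → octavian c +O octavian d ≡ octavian (c ℤᶜ.⊞ d)
octavian-⊞ c d = trans (fromBasis-⊞ (map fromℤ c) (map fromℤ d)) (cong fromBasis (sym (fromℤ-homomorphism.map-⊞ c d)))

octavian-⊟ : ∀ c → -O octavian c ≡ octavian (ℤᶜ.⊟ c)
octavian-⊟ c = trans (fromBasis-⊟ (map fromℤ c)) (cong fromBasis (sym (fromℤ-homomorphism.map-⊟ c)))

double : ∀ {n} → Vec ℤ n → Vec ℤ n
double = map (+ 2 ℤ.*_)

octavian-double : ∀ c → octavian (double c) ≡ 2O *O octavian c
octavian-double c = begin
  fromBasis (map fromℤ (map (+ 2 ℤ.*_) c))     ≡⟨ cong fromBasis fromℤ-double ⟩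
  fromBasis (map (2ℚ ℚ.*_) (map fromℤ c))      ≡⟨ fromBasis-scale 2ℚ (map fromℤ c) ⟨
  scale 2ℚ (octavian c)                        ≡⟨ 2O-* (octavian c) ⟨
  2O *O octavian c                             ∎
  where
  fromℤ-double : map fromℤ (map (+ 2 ℤ.*_) c) ≡ map (2ℚ ℚ.*_) (map fromℤ c)
  fromℤ-double = trans (sym (map-∘ fromℤ (+ 2 ℤ.*_) c)) (trans (map-cong (fromℤ-homo-* (+ 2)) c) (map-∘ (2ℚ ℚ.*_) fromℤ c))

map-injective : ∀ {A B : Set} {f : A → B} → (∀ {a b} → f a ≡ f b → a ≡ b) →
                ∀ {n} {u v : Vec A n} → map f u ≡ map f v → u ≡ v
map-injective f-inj {u = []}    {[]}    _  = refl
map-injective f-inj {u = a ∷ u} {b ∷ v} eq = cong₂ _∷_ (f-inj (∷-injectiveˡ eq)) (map-injective f-inj (∷-injectiveʳ eq))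

octavian-injective : ∀ {c d} → octavian c ≡ octavian d → c ≡ d
octavian-injective {c} {d} c≡d = map-injective fromℤ-injective (begin
  map fromℤ c                      ≡⟨ basisCoordinates-fromBasis (map fromℤ c) ⟨
  basisCoordinates (octavian c)    ≡⟨ cong basisCoordinates c≡d ⟩
  basisCoordinates (octavian d)    ≡⟨ basisCoordinates-fromBasis (map fromℤ d) ⟩
  map fromℤ d                      ∎)

N-octavian : ∀ c → N (octavian c) ≡ fromℤ (ℤᶜ.norm c)
N-octavian c@(_ ∷ _ ∷ _ ∷ _ ∷ _ ∷ _ ∷ _ ∷ _ ∷ []) = begin
  N o                                                       ≡⟨ head-basisCoordinates-real (N o) ⟨
  head (basisCoordinates (real (N o)))                      ≡⟨ cong (head ∘ basisCoordinates) (*-conj o) ⟨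
  head (basisCoordinates (o *O conjO o))                    ≡⟨ cong (head ∘ basisCoordinates) o*ō ⟩
  head (basisCoordinates (octavian (c ℤᶜ.∙ ℤᶜ.conj c)))     ≡⟨ cong head (basisCoordinates-fromBasis (map fromℤ (c ℤᶜ.∙ ℤᶜ.conj c))) ⟩
  fromℤ (ℤᶜ.norm c)                                         ∎
  where
  o = octavian c
  o*ō : o *O conjO o ≡ octavian (c ℤᶜ.∙ ℤᶜ.conj c)
  o*ō = trans (cong (o *O_) (octavian-conj c)) (octavian-∙ c (ℤᶜ.conj c))

natural-∈O : ∀ n → InO (real (fromℤ (+ n)))
natural-∈O zero    = add one (neg one)
natural-∈O (suc n) = subst (InO ∘ real) (sym (fromℤ-homo-+ (+ 1) (+ n))) (add one (natural-∈O n))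

integer-∈O : ∀ k → InO (real (fromℤ k))
integer-∈O (+ n)    = natural-∈O n
integer-∈O -[1+ n ] = neg (natural-∈O (suc n))

scale-∈O : ∀ k {x} → InO x → InO (scale (fromℤ k) x)
scale-∈O k {x} x∈O = subst InO (real-* (fromℤ k) x) (mul (integer-∈O k) x∈O)

combination-∈O : ∀ {n} {bs : Vec Oct n} → AllV InO bs → ∀ c → InO (combination (map fromℤ c) bs)
combination-∈O []           []      = add one (neg one)
combination-∈O (b∈O ∷ bs∈O) (k ∷ c) = add (scale-∈O k b∈O) (combination-∈O bs∈O c)

octavian-∈O : ∀ c → InO (octavian c)
octavian-∈O = combination-∈O basis-∈O

unit : Fin 8 → Vec ℤ 8
unit i = replicate 8 (+ 0) [ i ]≔ + 1

∈O⇒octavian : ∀ {x} → InO x → ∃ λ c → x ≡ octavian c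
∈O⇒octavian gen₁ = unit 1F , refl
∈O⇒octavian gen₂ = unit 2F , refl
∈O⇒octavian gen₄ = unit 3F , refl
∈O⇒octavian one  = unit 0F , refl
∈O⇒octavian (neg x∈O) =
  let c , x≡c = ∈O⇒octavian x∈O
  in ℤᶜ.⊟ c , trans (cong -O_ x≡c) (octavian-⊟ c)
∈O⇒octavian (add x∈O y∈O) =
  let c , x≡c = ∈O⇒octavian x∈O
      d , y≡d = ∈O⇒octavian y∈O
  in c ℤᶜ.⊞ d , trans (cong₂ _+O_ x≡c y≡d) (octavian-⊞ c d)
∈O⇒octavian (mul x∈O y∈O) =
  let c , x≡c = ∈O⇒octavian x∈O
      d , y≡d = ∈O⇒octavian y∈O
  in c ℤᶜ.∙ d , trans (cong₂ _*O_ x≡c y≡d) (octavian-∙ c d)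

conj-∈O : ∀ {x} → InO x → InO (conjO x)
conj-∈O x∈O =
  let c , x≡c = ∈O⇒octavian x∈O
  in subst InO (sym (trans (cong conjO x≡c) (octavian-conj c))) (octavian-∈O (ℤᶜ.conj c))

-- Reduction modulo 2

module O/2O = Coordinates ℙ._+_ ℙ._*_ id
open O/2O using (_∙_; conj; norm; _⊞_)

module reduction = Homomorphism ℤ._+_ ℤ._*_ ℤ.-_ ℙ._+_ ℙ._*_ id parityℤ parityℤ-homo-+ parityℤ-homo-* parityℤ-homo‿-

reduce : ∀ {n} → Vec ℤ n → Vec Parity n
reduce = map parityℤ

lift : Vec Parity 8 → Vec ℤ 8
lift = map toℤ

reduce-lift : ∀ ζ → reduce (lift ζ) ≡ ζ
reduce-lift ζ = trans (sym (map-∘ parityℤ toℤ ζ)) (trans (map-cong parityℤ-toℤ ζ) (map-id ζ))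

0₂ : ∀ {n} → Vec Parity n
0₂ = replicate _ 0ℙ

reduce-double : ∀ {n} (c : Vec ℤ n) → reduce (double c) ≡ 0₂
reduce-double c = trans (sym (map-∘ parityℤ (+ 2 ℤ.*_) c)) (trans (map-cong (parityℤ-homo-* (+ 2)) c) (map-const c 0ℙ))

reduce≡0⇒double : ∀ {n} (c : Vec ℤ n) → reduce c ≡ 0₂ → c ≡ double (map (_/ℕ 2) c)
reduce≡0⇒double []      _  = refl
reduce≡0⇒double (i ∷ c) eq = cong₂ _∷_ i≡2*[i/2] (reduce≡0⇒double c (∷-injectiveʳ eq))
  where
  i≡2*[i/2] : i ≡ + 2 ℤ.* (i /ℕ 2)
  i≡2*[i/2] = begin
    i                                         ≡⟨ i≡2*[i/2]+parity i ⟩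
    + 2 ℤ.* (i /ℕ 2) ℤ.+ toℤ (parityℤ i)      ≡⟨ cong (λ p → + 2 ℤ.* (i /ℕ 2) ℤ.+ toℤ p) (∷-injectiveˡ eq) ⟩
    + 2 ℤ.* (i /ℕ 2) ℤ.+ + 0                  ≡⟨ ℤ.+-identityʳ _ ⟩
    + 2 ℤ.* (i /ℕ 2)                          ∎

octavian∈2O⇔reduce≡0 : ∀ c → In2O (octavian c) ⇔ reduce c ≡ 0₂
octavian∈2O⇔reduce≡0 c = mk⇔ to from
  where
  to : In2O (octavian c) → reduce c ≡ 0₂
  to (x , x∈O , c≡2x) =
    let d , x≡d = ∈O⇒octavian x∈O
    in trans (cong reduce (octavian-injective (trans c≡2x (trans (cong (2O *O_) x≡d) (sym (octavian-double d))))))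
             (reduce-double d)
  from : reduce c ≡ 0₂ → In2O (octavian c)
  from c≡0 = octavian h , octavian-∈O h , trans (cong octavian (reduce≡0⇒double c c≡0)) (octavian-double h)
    where h = map (_/ℕ 2) c

isotropic-class : ∀ c → N (octavian c) ≡ 2ℚ → norm (reduce c) ≡ 0ℙ
isotropic-class c Nc = begin
  norm (reduce c)          ≡⟨ reduction.norm-homo c ⟨
  parityℤ (ℤᶜ.norm c)      ≡⟨ cong parityℤ (fromℤ-injective (trans (sym (N-octavian c)) Nc)) ⟩
  parityℤ (+ 2)            ∎

-- The finite facts about O/2O

[1] [ω₁] [ω₂] [ω₄] : Vec Parity 8
[1]  = reduce (unit 0F)
[ω₁] = reduce (unit 1F)
[ω₂] = reduce (unit 2F)
[ω₄] = reduce (unit 3F)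

infix 4 _≟₂_
_≟₂_ : (a b : Vec Parity 8) → Dec (a ≡ b)
_≟₂_ = ≡-dec ℙ._≟_

vectors : ∀ n → List (Vec Parity n)
vectors zero    = [] ∷ []
vectors (suc n) = List.map (0ℙ ∷_) (vectors n) List.++ List.map (1ℙ ∷_) (vectors n)

∈-vectors : ∀ {n} (v : Vec Parity n) → v ∈ vectors n
∈-vectors []                = here refl
∈-vectors (0ℙ ∷ v)          = ∈-++⁺ˡ (∈-map⁺ (0ℙ ∷_) (∈-vectors v))
∈-vectors {suc n} (1ℙ ∷ v) = ∈-++⁺ʳ (List.map (0ℙ ∷_) (vectors n)) (∈-map⁺ (1ℙ ∷_) (∈-vectors v))

isotropic : List (Vec Parity 8)
isotropic = filter (λ v → norm v ℙ.≟ 0ℙ) (vectors 8)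

∈-isotropic : ∀ {v} → norm v ≡ 0ℙ → v ∈ isotropic
∈-isotropic {v} = ∈-filter⁺ (λ v → norm v ℙ.≟ 0ℙ) (∈-vectors v)

-- The list is an argument, so that it is evaluated once and not once for every a.
all-pairs : ∀ {A : Set} → List A → (A → A → Bool) → Bool
all-pairs l p = all (λ a → all (p a) l) l

all-pairs-sound : ∀ {A : Set} (l : List A) p → T (all-pairs l p) → ∀ {a b} → a ∈ l → b ∈ l → T (p a b)
all-pairs-sound l p t a∈l b∈l = All.lookup (all⁺ (p _) l (All.lookup (all⁺ _ l t) a∈l)) b∈l

all-unordered-pairs : ∀ {A : Set} → List A → (A → A → Bool) → Bool
all-unordered-pairs []      p = true
all-unordered-pairs (a ∷ l) p = all (p a) (a ∷ l) ∧ all-unordered-pairs l p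

all-unordered-pairs-sound : ∀ {A : Set} (l : List A) p → T (all-unordered-pairs l p) →
                            ∀ {a b} → a ∈ l → b ∈ l → T (p a b) ⊎ T (p b a)
all-unordered-pairs-sound (x ∷ l) p t a∈ b∈ with Equivalence.to (T-∧ {all (p x) (x ∷ l)}) t
all-unordered-pairs-sound (x ∷ l) p t (here refl) b∈         | t₁ , _  = inj₁ (All.lookup (all⁺ (p x) (x ∷ l) t₁) b∈)
all-unordered-pairs-sound (x ∷ l) p t (there a∈) (here refl) | t₁ , _  = inj₂ (All.lookup (all⁺ (p x) (x ∷ l) t₁) (there a∈))
all-unordered-pairs-sound (x ∷ l) p t (there a∈) (there b∈)  | _  , t₂ = all-unordered-pairs-sound l p t₂ a∈ b∈

LeftRightAnnihilator LeftLeftAnnihilator : Vec Parity 8 → Vec Parity 8 → Vec Parity 8 → Set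
LeftRightAnnihilator a b ζ = ζ ≢ 0₂ × ζ ∙ conj a ≡ 0₂ × conj b ∙ ζ ≡ 0₂
LeftLeftAnnihilator  a b ζ = ζ ≢ 0₂ × ζ ∙ conj a ≡ 0₂ × ζ ∙ conj b ≡ 0₂

-- For a lift z = s' s of b a there is nothing to check beyond b a ≢ 0, as z ∈ O s ∩ s' O;
-- the other candidates cover the pairs with b a = 0.
left-right-annihilator : ∀ a b → norm a ≡ 0ℙ → norm b ≡ 0ℙ → b ∙ a ≢ 0₂ ⊎ ∃ (LeftRightAnnihilator a b)
left-right-annihilator a b Na Nb =
  map₂ satisfied (toWitness {a? = check a b}
    (all-pairs-sound isotropic (λ a b → isYes (check a b)) tt {a} {b} (∈-isotropic Na) (∈-isotropic Nb)))
  where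
  candidates : Vec Parity 8 → Vec Parity 8 → List (Vec Parity 8)
  candidates a b = a ∷ b ∷ b ∙ ([ω₁] ∙ a) ∷ [1] ∷ []
  check : ∀ a b → Dec (b ∙ a ≢ 0₂ ⊎ Any (LeftRightAnnihilator a b) (candidates a b))
  check a b = ¬? (b ∙ a ≟₂ 0₂) ⊎-dec
              any? (λ ζ → ¬? (ζ ≟₂ 0₂) ×-dec (ζ ∙ conj a ≟₂ 0₂) ×-dec (conj b ∙ ζ ≟₂ 0₂)) (candidates a b)

-- A lift z = s̄ s' of ā b lies in O s', so only ā b ≢ 0 and its annihilation of ā are checked.
LeftLeftCase : Vec Parity 8 → Vec Parity 8 → Set
LeftLeftCase a b = (conj a ∙ b ≢ 0₂ × (conj a ∙ b) ∙ conj a ≡ 0₂) ⊎ ∃ (LeftLeftAnnihilator a b)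

left-left-annihilator : ∀ a b → norm a ≡ 0ℙ → norm b ≡ 0ℙ → norm (a ⊞ b) ≡ 0ℙ → LeftLeftCase a b ⊎ LeftLeftCase b a
left-left-annihilator a b Na Nb Na+b =
  Sum.map (λ t → map₂ satisfied (toWitness t Na+b)) (λ t → map₂ satisfied (toWitness t Nb+a))
    (all-unordered-pairs-sound isotropic (λ a b → isYes (check a b)) tt {a} {b} (∈-isotropic Na) (∈-isotropic Nb))
  where
  Nb+a : norm (b ⊞ a) ≡ 0ℙ
  Nb+a = trans (cong norm (zipWith-comm ℙ.+-comm b a)) Na+b
  candidates : Vec Parity 8 → Vec Parity 8 → List (Vec Parity 8)
  candidates a b = ([ω₁] ∙ conj a) ∙ b ∷ a ∷ ([ω₂] ∙ conj a) ∙ b ∷ b ∷ b ∙ a ∷ ([ω₄] ∙ conj a) ∙ b ∷ [1] ∷ []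
  check : ∀ a b → Dec (norm (a ⊞ b) ≡ 0ℙ →
                       (conj a ∙ b ≢ 0₂ × (conj a ∙ b) ∙ conj a ≡ 0₂) ⊎ Any (LeftLeftAnnihilator a b) (candidates a b))
  check a b = (norm (a ⊞ b) ℙ.≟ 0ℙ) →-dec
              ((¬? (conj a ∙ b ≟₂ 0₂) ×-dec ((conj a ∙ b) ∙ conj a ≟₂ 0₂)) ⊎-dec
               any? (λ ζ → ¬? (ζ ≟₂ 0₂) ×-dec (ζ ∙ conj a ≟₂ 0₂) ×-dec (ζ ∙ conj b ≟₂ 0₂)) (candidates a b))

-- Elements of the intersections outside 2O

Witness : (Oct → Set) → Set
Witness A = ∃ λ z → A z × ¬ In2O z

witness⇒≢2O : ∀ {A} → Witness A → ¬ SameSet A In2O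
witness⇒≢2O (z , z∈A , z∉2O) A≡2O = z∉2O (proj₁ (A≡2O z) z∈A)

swap-witness : ∀ {A B : Oct → Set} → Witness (λ z → A z × B z) → Witness (λ z → B z × A z)
swap-witness (z , z∈A∩B , z∉2O) = z , swap z∈A∩B , z∉2O

annihilator⇒∈O· : ∀ c t → N (octavian c) ≡ 2ℚ → reduce t ∙ conj (reduce c) ≡ 0₂ → octavian t ∈O· octavian c
annihilator⇒∈O· c t Nc t*c̄≡0 =
  let x , x∈O , t*c̄≡2x = Equivalence.from (octavian∈2O⇔reduce≡0 (t ℤᶜ.∙ ℤᶜ.conj c)) reduce≡0
  in x , x∈O , divide-right (octavian c) (octavian t) x Nc (trans t*c̄ t*c̄≡2x)
  where
  reduce≡0 : reduce (t ℤᶜ.∙ ℤᶜ.conj c) ≡ 0₂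
  reduce≡0 = trans (reduction.map-∙ t (ℤᶜ.conj c)) (trans (cong (reduce t ∙_) (reduction.map-conj c)) t*c̄≡0)
  t*c̄ : octavian t *O conjO (octavian c) ≡ octavian (t ℤᶜ.∙ ℤᶜ.conj c)
  t*c̄ = trans (cong (octavian t *O_) (octavian-conj c)) (octavian-∙ t (ℤᶜ.conj c))

annihilator⇒∈·O : ∀ c t → N (octavian c) ≡ 2ℚ → conj (reduce c) ∙ reduce t ≡ 0₂ → octavian t ∈·O octavian c
annihilator⇒∈·O c t Nc c̄*t≡0 =
  let y , y∈O , c̄*t≡2y = Equivalence.from (octavian∈2O⇔reduce≡0 (ℤᶜ.conj c ℤᶜ.∙ t)) reduce≡0
  in y , y∈O , divide-left (octavian c) (octavian t) y Nc (trans c̄*t c̄*t≡2y)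
  where
  reduce≡0 : reduce (ℤᶜ.conj c ℤᶜ.∙ t) ≡ 0₂
  reduce≡0 = trans (reduction.map-∙ (ℤᶜ.conj c) t) (trans (cong (_∙ reduce t) (reduction.map-conj c)) c̄*t≡0)
  c̄*t : conjO (octavian c) *O octavian t ≡ octavian (ℤᶜ.conj c ℤᶜ.∙ t)
  c̄*t = trans (cong (_*O octavian t) (octavian-conj c)) (octavian-∙ (ℤᶜ.conj c) t)

product-∉2O : ∀ c d → reduce c ∙ reduce d ≢ 0₂ → ¬ In2O (octavian c *O octavian d)
product-∉2O c d cd≢0 cd∈2O =
  cd≢0 (trans (sym (reduction.map-∙ c d))
              (Equivalence.to (octavian∈2O⇔reduce≡0 (c ℤᶜ.∙ d)) (subst In2O (octavian-∙ c d) cd∈2O)))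

lift-∉2O : ∀ ζ → ζ ≢ 0₂ → ¬ In2O (octavian (lift ζ))
lift-∉2O ζ ζ≢0 ζ∈2O = ζ≢0 (trans (sym (reduce-lift ζ)) (Equivalence.to (octavian∈2O⇔reduce≡0 (lift ζ)) ζ∈2O))

left-right-witness : ∀ c d → N (octavian c) ≡ 2ℚ → N (octavian d) ≡ 2ℚ →
                     Witness (λ z → (z ∈O· octavian c) × (z ∈·O octavian d))
left-right-witness c d Nc Nd = witness (left-right-annihilator a b (isotropic-class c Nc) (isotropic-class d Nd))
  where
  a = reduce c
  b = reduce d
  witness : b ∙ a ≢ 0₂ ⊎ ∃ (LeftRightAnnihilator a b) → Witness (λ z → (z ∈O· octavian c) × (z ∈·O octavian d))
  witness (inj₁ ba≢0) =
    octavian d *O octavian c ,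
    ((octavian d , octavian-∈O d , refl) , (octavian c , octavian-∈O c , refl)) ,
    product-∉2O d c ba≢0
  witness (inj₂ (ζ , ζ≢0 , ζā≡0 , b̄ζ≡0)) =
    octavian (lift ζ) ,
    (annihilator⇒∈O· c (lift ζ) Nc (subst (λ u → u ∙ conj a ≡ 0₂) (sym (reduce-lift ζ)) ζā≡0) ,
     annihilator⇒∈·O d (lift ζ) Nd (subst (λ u → conj b ∙ u ≡ 0₂) (sym (reduce-lift ζ)) b̄ζ≡0)) ,
    lift-∉2O ζ ζ≢0

left-left-case-witness : ∀ c d → N (octavian c) ≡ 2ℚ → N (octavian d) ≡ 2ℚ → LeftLeftCase (reduce c) (reduce d) →
                         Witness (λ z → (z ∈O· octavian c) × (z ∈O· octavian d))
left-left-case-witness c d Nc Nd (inj₁ (āb≢0 , ābā≡0)) =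
  octavian c̄ *O octavian d ,
  (subst (_∈O· octavian c) (sym (octavian-∙ c̄ d)) (annihilator⇒∈O· c (c̄ ℤᶜ.∙ d) Nc c̄d*c̄≡0) ,
   (octavian c̄ , octavian-∈O c̄ , refl)) ,
  product-∉2O c̄ d (subst (λ u → u ∙ reduce d ≢ 0₂) (sym (reduction.map-conj c)) āb≢0)
  where
  c̄ = ℤᶜ.conj c
  c̄d*c̄≡0 : reduce (c̄ ℤᶜ.∙ d) ∙ conj (reduce c) ≡ 0₂
  c̄d*c̄≡0 = trans (cong (_∙ conj (reduce c)) (trans (reduction.map-∙ c̄ d) (cong (_∙ reduce d) (reduction.map-conj c))))
                  ābā≡0
left-left-case-witness c d Nc Nd (inj₂ (ζ , ζ≢0 , ζā≡0 , ζb̄≡0)) =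
  octavian (lift ζ) ,
  (annihilator⇒∈O· c (lift ζ) Nc (subst (λ u → u ∙ conj (reduce c) ≡ 0₂) (sym (reduce-lift ζ)) ζā≡0) ,
   annihilator⇒∈O· d (lift ζ) Nd (subst (λ u → u ∙ conj (reduce d) ≡ 0₂) (sym (reduce-lift ζ)) ζb̄≡0)) ,
  lift-∉2O ζ ζ≢0

left-left-witness : ∀ c d → N (octavian c) ≡ 2ℚ → N (octavian d) ≡ 2ℚ → parityℤ (ℤᶜ.norm (c ℤᶜ.⊞ d)) ≡ 0ℙ →
                    Witness (λ z → (z ∈O· octavian c) × (z ∈O· octavian d))
left-left-witness c d Nc Nd even =
  witness (left-left-annihilator (reduce c) (reduce d) (isotropic-class c Nc) (isotropic-class d Nd) orthogonal)
  where
  orthogonal : norm (reduce c ⊞ reduce d) ≡ 0ℙ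
  orthogonal = trans (cong norm (sym (reduction.map-⊞ c d))) (trans (sym (reduction.norm-homo (c ℤᶜ.⊞ d))) even)
  witness : LeftLeftCase (reduce c) (reduce d) ⊎ LeftLeftCase (reduce d) (reduce c) →
            Witness (λ z → (z ∈O· octavian c) × (z ∈O· octavian d))
  witness (inj₁ case) = left-left-case-witness c d Nc Nd case
  witness (inj₂ case) = swap-witness (left-left-case-witness d c Nd Nc case)

intersection≡2O⇒odd-norm : ∀ c d → N (octavian c) ≡ 2ℚ → N (octavian d) ≡ 2ℚ →
                           SameSet (λ z → (z ∈O· octavian c) × (z ∈O· octavian d)) In2O →
                           OddQ (N (octavian c +O octavian d))
intersection≡2O⇒odd-norm c d Nc Nd ∩≡2O = odd (even-or-odd M)
  where
  M = ℤᶜ.norm (c ℤᶜ.⊞ d)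
  odd : parityℤ M ≡ 0ℙ ⊎ M ≡ + 2 ℤ.* (M /ℕ 2) ℤ.+ + 1 → OddQ (N (octavian c +O octavian d))
  odd (inj₁ even)   = ⊥-elim (witness⇒≢2O (left-left-witness c d Nc Nd even) ∩≡2O)
  odd (inj₂ M≡2k+1) = M /ℕ 2 , (begin
    N (octavian c +O octavian d)             ≡⟨ cong N (octavian-⊞ c d) ⟩
    N (octavian (c ℤᶜ.⊞ d))                  ≡⟨ N-octavian (c ℤᶜ.⊞ d) ⟩
    fromℤ M                                  ≡⟨ cong fromℤ M≡2k+1 ⟩
    fromℤ (+ 2 ℤ.* (M /ℕ 2) ℤ.+ + 1)         ≡⟨ fromℤ-/1 _ ⟨
    (+ 2 ℤ.* (M /ℕ 2) ℤ.+ + 1) / 1           ∎)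

2O⊆O· : ∀ {s z} → InO s → N s ≡ 2ℚ → In2O z → z ∈O· s
2O⊆O· {s} {z} s∈O Ns (u , u∈O , z≡2u) = u *O conjO s , mul u∈O (conj-∈O s∈O) , (begin
  z                      ≡⟨ z≡2u ⟩
  2O *O u                ≡⟨ 2O-* u ⟩
  scale 2ℚ u             ≡⟨ cong (λ t → scale t u) Ns ⟨
  scale (N s) u          ≡⟨ *-conj-* u s ⟨
  (u *O conjO s) *O s    ∎)

right-multiple⇒*conj : ∀ s z x → N s ≡ 2ℚ → z ≡ x *O s → z *O conjO s ≡ 2O *O x
right-multiple⇒*conj s z x Ns z≡xs =
  trans (cong (_*O conjO s) z≡xs) (trans (*-*-conj x s) (trans (cong (λ t → scale t x) Ns) (sym (2O-* x))))

norm-sum-multiple : ∀ s s' z x y → N s ≡ 2ℚ → N s' ≡ 2ℚ → z ≡ x *O s → z ≡ y *O s' →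
                    scale (N (s +O s')) z ≡ 2O *O ((x +O y) *O (s +O s'))
norm-sum-multiple s s' z x y Ns Ns' z≡xs z≡ys' = begin
  scale (N (s +O s')) z                      ≡⟨ *-conj-* z (s +O s') ⟨
  (z *O conjO (s +O s')) *O (s +O s')        ≡⟨ cong (_*O (s +O s')) z*conj ⟩
  (2O *O (x +O y)) *O (s +O s')              ≡⟨ 2O-*ˡ (x +O y) (s +O s') ⟩
  2O *O ((x +O y) *O (s +O s'))              ∎
  where
  z*conj : z *O conjO (s +O s') ≡ 2O *O (x +O y)
  z*conj = begin
    z *O conjO (s +O s')                     ≡⟨ cong (z *O_) (conj-+ s s') ⟩
    z *O (conjO s +O conjO s')               ≡⟨ *-distribˡ-+ z (conjO s) (conjO s') ⟩
    (z *O conjO s) +O (z *O conjO s')        ≡⟨ cong₂ _+O_ (right-multiple⇒*conj s z x Ns z≡xs)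
                                                             (right-multiple⇒*conj s' z y Ns' z≡ys') ⟩
    (2O *O x) +O (2O *O y)                   ≡⟨ *-distribˡ-+ 2O x y ⟨
    2O *O (x +O y)                           ∎

odd-multiple-∈2O : ∀ k {z} → InO z → In2O (scale (fromℤ (+ 2 ℤ.* k ℤ.+ + 1)) z) → In2O z
odd-multiple-∈2O k {z} z∈O (w , w∈O , mz≡2w) = w -O kz , add w∈O (neg (scale-∈O k z∈O)) , (begin
  z                                                   ≡⟨ scale-odd-minus-double (fromℤ k) z ⟨
  scale (2ℚ ℚ.* fromℤ k ℚ.+ 1ℚ) z -O (2O *O kz)       ≡⟨ cong (λ t → scale t z -O (2O *O kz)) fromℤ-2k+1 ⟨
  scale (fromℤ (+ 2 ℤ.* k ℤ.+ + 1)) z -O (2O *O kz)   ≡⟨ cong (_-O (2O *O kz)) mz≡2w ⟩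
  (2O *O w) -O (2O *O kz)                             ≡⟨ 2O-*-distrib-minus w kz ⟨
  2O *O (w -O kz)                                     ∎)
  where
  kz = scale (fromℤ k) z
  fromℤ-2k+1 : fromℤ (+ 2 ℤ.* k ℤ.+ + 1) ≡ 2ℚ ℚ.* fromℤ k ℚ.+ 1ℚ
  fromℤ-2k+1 = trans (fromℤ-homo-+ (+ 2 ℤ.* k) (+ 1)) (cong (ℚ._+ 1ℚ) (fromℤ-homo-* (+ 2) k))

odd-norm⇒intersection≡2O : ∀ {s s'} → InO s → InO s' → N s ≡ 2ℚ → N s' ≡ 2ℚ → OddQ (N (s +O s')) →
                           SameSet (λ z → (z ∈O· s) × (z ∈O· s')) In2O
odd-norm⇒intersection≡2O {s} {s'} s∈O s'∈O Ns Ns' (k , N≡2k+1) z = to , from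
  where
  to : (z ∈O· s) × (z ∈O· s') → In2O z
  to ((x , x∈O , z≡xs) , (y , y∈O , z≡ys')) =
    odd-multiple-∈2O k (subst InO (sym z≡xs) (mul x∈O s∈O))
      ((x +O y) *O (s +O s') , mul (add x∈O y∈O) (add s∈O s'∈O) ,
       trans (cong (λ t → scale t z) (sym (trans N≡2k+1 (fromℤ-/1 _)))) (norm-sum-multiple s s' z x y Ns Ns' z≡xs z≡ys'))
  from : In2O z → (z ∈O· s) × (z ∈O· s')
  from z∈2O = 2O⊆O· s∈O Ns z∈2O , 2O⊆O· s'∈O Ns' z∈2O

on-coordinates : (P : Oct → Oct → Set) → (∀ c d → N (octavian c) ≡ 2ℚ → N (octavian d) ≡ 2ℚ → P (octavian c) (octavian d)) →
                 ∀ {s s'} → InO s → InO s' → N s ≡ 2ℚ → N s' ≡ 2ℚ → P s s'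
on-coordinates P f s∈O s'∈O Ns Ns' =
  let c , s≡c = ∈O⇒octavian s∈O
      d , s'≡d = ∈O⇒octavian s'∈O
  in subst₂ P (sym s≡c) (sym s'≡d) (f c d (trans (cong N (sym s≡c)) Ns) (trans (cong N (sym s'≡d)) Ns'))

mainTheorem5 : ∀ (s s' : Oct) → InO s → InO s' → N s ≡ 2ℚ → N s' ≡ 2ℚ
               → ¬ CongMod2O s s'
               → (¬ SameSet (λ z → (z ∈O· s) × (z ∈·O s')) In2O)
                 × (SameSet (λ z → (z ∈O· s) × (z ∈O· s')) In2O ⇔ OddQ (N (s +O s')))
mainTheorem5 s s' s∈O s'∈O Ns Ns' _ =
  witness⇒≢2O (on-coordinates (λ s s' → Witness (λ z → (z ∈O· s) × (z ∈·O s'))) left-right-witness s∈O s'∈O Ns Ns') ,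
  mk⇔ (on-coordinates (λ s s' → SameSet (λ z → (z ∈O· s) × (z ∈O· s')) In2O → OddQ (N (s +O s')))
                      intersection≡2O⇒odd-norm s∈O s'∈O Ns Ns')
      (odd-norm⇒intersection≡2O s∈O s'∈O Ns Ns')
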